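{- For every $k\ge1$, $\mathsf{SRT}^2_k\le_W\mathrm{Ind}\,\mathscr{E}_k$.
   Context: A problem is a partial multivalued function $P\colon\subseteq\mathbb{N}^\mathbb{N}\rightrightarrows\mathbb{N}^\mathbb{N}$. $P\le_W Q$ means there are Turing functionals $\Delta,\Psi$ with $\Delta^p\in\mathrm{dom}\,Q$ for all $p\in\mathrm{dom}\,P$ and $\Psi^{p\oplus q}\in P(p)$ for all $q\in Q(\Delta^p)$. $\mathscr{E}$ is the structure with one binary relation that is an equivalence relation with countably infinitely many classes, each countably infinite. $\mathrm{Ind}\,\mathscr{E}_k$: instances are pairs $\langle\mathcal{A},c\rangle$ with $\mathcal{A}$ a presentation of $\mathscr{E}$ and $c\colon\mathrm{dom}\,\mathcal{A}\to\{0,\dots,k-1\}$; solutions are $c$-monochromatic sets whose induced substructure is isomorphic to $\mathscr{E}$. $\mathsf{SRT}^2_k$: instances are colorings $c\colon[\mathbb{N}]^2\to\{0,\dots,k-1\}$ that are stable, i.e. $\lim_m c\{n,m\}$ exists for every $n$; solutions are infinite sets $H$ with $c$ constant on $[H]^2$. -}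

module Defs where

open import Data.Nat using (ℕ; zero; suc; _+_; _<_; _≤_; _>_; _≥_)
open import Data.Fin using (Fin)
open import Data.Vec using (Vec; []; _∷_; lookup)
open import Data.Product using (Σ; _×_; _,_; proj₁; proj₂)
open import Relation.Binary.PropositionalEquality using (_≡_)
open import Function.Bundles using (_⤖_; _⇔_; Bijection)

Baire : Set
Baire = ℕ → ℕ

tri : ℕ → ℕ
tri zero = zero
tri (suc k) = tri k + suc k

pair : ℕ → ℕ → ℕ
pair n m = tri (n + m) + m

-- p ⊕ q : (p ⊕ q)(2n) = p n, (p ⊕ q)(2n+1) = q n
join : Baire → Baire → Baire
join p q zero = p zero
join p q (suc zero) = q zero
join p q (suc (suc n)) = join (λ i → p (suc i)) (λ i → q (suc i)) n

-- Turing functionals: oracle partial recursive (μ-recursive) codes with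
-- a big-step evaluation relation relative to an oracle f.

data Code : ℕ → Set where
  zeroC  : ∀ {n} → Code n
  succC  : Code 1
  projC  : ∀ {n} → Fin n → Code n
  oracle : Code 1
  comp   : ∀ {m n} → Code m → Vec (Code n) m → Code n
  prec   : ∀ {n} → Code n → Code (suc (suc n)) → Code (suc n)
  mu     : ∀ {n} → Code (suc n) → Code n

mutual
  data Eval (f : Baire) : ∀ {n} → Code n → Vec ℕ n → ℕ → Set where
    evZero : ∀ {n} {xs : Vec ℕ n} → Eval f zeroC xs 0
    evSucc : ∀ {x} → Eval f succC (x ∷ []) (suc x)
    evProj : ∀ {n} {i : Fin n} {xs} → Eval f (projC i) xs (lookup xs i)
    evOrac : ∀ {x} → Eval f oracle (x ∷ []) (f x)
    evComp : ∀ {m n} {g : Code m} {hs : Vec (Code n) m} {xs ys v} →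
             EvalAll f hs xs ys → Eval f g ys v → Eval f (comp g hs) xs v
    evPrec0 : ∀ {n} {g : Code n} {h : Code (suc (suc n))} {xs v} →
              Eval f g xs v → Eval f (prec g h) (0 ∷ xs) v
    evPrecS : ∀ {n} {g : Code n} {h : Code (suc (suc n))} {xs y u v} →
              Eval f (prec g h) (y ∷ xs) u → Eval f h (y ∷ u ∷ xs) v →
              Eval f (prec g h) (suc y ∷ xs) v
    evMu   : ∀ {n} {g : Code (suc n)} {xs y} →
             Eval f g (y ∷ xs) 0 →
             (∀ z → z < y → Σ ℕ (λ v → Eval f g (z ∷ xs) (suc v))) →
             Eval f (mu g) xs y

  data EvalAll (f : Baire) {n : ℕ} : ∀ {m} → Vec (Code n) m → Vec ℕ n → Vec ℕ m → Set where
    [] : ∀ {xs} → EvalAll f [] xs []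
    _∷_ : ∀ {m} {h : Code n} {hs : Vec (Code n) m} {xs y ys} →
          Eval f h xs y → EvalAll f hs xs ys → EvalAll f (h ∷ hs) xs (y ∷ ys)

TuringFunctional : Set
TuringFunctional = Code 1

_^_≃_ : TuringFunctional → Baire → Baire → Set
Φ ^ p ≃ x = ∀ n → Eval p Φ (n ∷ []) (x n)

record Problem : Set₁ where
  field
    dom : Baire → Set
    sol : Baire → Baire → Set     -- sol p y : y ∈ P(p)
open Problem public

_≤W_ : Problem → Problem → Set
P ≤W Q = Σ TuringFunctional λ Δ → Σ TuringFunctional λ Ψ →
  ∀ p → dom P p →
    Σ Baire λ x → (Δ ^ p ≃ x) × dom Q x ×
      (∀ q → sol Q x q →
         Σ Baire λ y → (Ψ ^ join p q ≃ y) × sol P p y)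

-- Sets coded by characteristic functions

IsChar : Baire → Set
IsChar h = ∀ x → h x ≤ 1

Infinite : Baire → Set
Infinite h = ∀ N → Σ ℕ λ x → (x ≥ N) × (h x ≡ 1)

-- SRT²_k : an instance p codes c{n,m} = p ⟨n,m⟩ for n < m

SRT2 : ℕ → Problem
dom (SRT2 k) p =
  (∀ n m → n < m → p (pair n m) < k) ×
  (∀ n → Σ ℕ λ i → Σ ℕ λ s → ∀ m → m > s → p (pair n m) ≡ i)
sol (SRT2 k) p h =
  IsChar h × Infinite h ×
  Σ ℕ λ i → ∀ x y → x < y → h x ≡ 1 → h y ≡ 1 → p (pair x y) ≡ i

E𝓔 : ℕ × ℕ → ℕ × ℕ → Set
E𝓔 u v = proj₁ u ≡ proj₁ v

IsoToE : (D : Set) → (D → D → Set) → Set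
IsoToE D R = Σ (D ⤖ (ℕ × ℕ)) λ f →
  ∀ x y → R x y ⇔ E𝓔 (Bijection.to f x) (Bijection.to f y)

RelOf : Baire → ℕ → ℕ → Set
RelOf a x y = a (pair x y) ≡ 1

-- Ind 𝓔_k : instance p = a ⊕ c with a a presentation of 𝓔, c a k-colouring
evenPart oddPart : Baire → Baire
evenPart p n = p (n + n)
oddPart p n = p (suc (n + n))

IndE : ℕ → Problem
dom (IndE k) p =
  (∀ z → evenPart p z ≤ 1) × IsoToE ℕ (RelOf (evenPart p)) ×
  (∀ x → oddPart p x < k)
sol (IndE k) p h =
  IsChar h ×
  (Σ ℕ λ i → ∀ x → h x ≡ 1 → oddPart p x ≡ i) ×
  IsoToE (Σ ℕ λ x → h x ≡ 1)
         (λ u v → RelOf (evenPart p) (proj₁ u) (proj₁ v))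

{-# OPTIONS --safe #-}
-- Δ presents 𝓔 on ℕ with ⟨n , m⟩ in class n and colours that element by c{n , n + m + 1}.
-- Let H be a monochromatic copy of 𝓔, of colour i. Every class that H meets contains infinitely
-- many elements of H, so by stability lim_m c{n , m} = i for each such class n, and H meets
-- classes of arbitrarily large index. Hence Ψ can pick x₁ < x₂ < … in H greedily: x_{j+1} is the
-- least element of H whose class index exceeds x_j and with c{π₁ y , π₁ x_{j+1}} equal to the
-- colour of y (that is, to i, which Ψ does not know) for every y ∈ H below x_j. The class indices
-- π₁ x_{j+1} then form an infinite homogeneous set of colour i.
-- Computability is witnessed by arithmetic terms with bounded sums, one μ-search per step.
module Submission where

open import Defs
open import Data.Nat using (ℕ; zero; suc; pred; _+_; _∸_; _⊓_; _<_; _≤_; _>_; _≥_; z≤n; s≤s; _≟_; _<?_; ⌊_/2⌋; ∣_-_∣)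
open import Data.Nat.Properties
open import Data.Fin using (Fin; zero; suc; toℕ; fromℕ<)
open import Data.Fin.Properties using (any?; injective⇒≤; toℕ-fromℕ<; toℕ-injective)
open import Data.Vec using (Vec; []; _∷_; lookup; tabulate)
open import Data.Vec.Properties using (tabulate∘lookup)
open import Data.Empty using (⊥-elim)
open import Data.Sum using (inj₁; inj₂)
open import Data.Product using (Σ; _×_; _,_; proj₁; proj₂; uncurry)
open import Function.Base using (_∘_; _on_)
open import Function.Bundles using (_⤖_; _⇔_; Bijection; Equivalence; mk⇔; mk↔ₛ′)
open import Function.Properties.Inverse using (↔⇒⤖)
open import Relation.Nullary using (¬_; yes; no)
open import Relation.Unary as U using ()
open import Relation.Binary.PropositionalEquality
open import Relation.Binary.Definitions using (tri<; tri≈; tri>)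

-- Sums, indicators and halving

sumBelow : (ℕ → ℕ) → ℕ → ℕ
sumBelow f zero = 0
sumBelow f (suc y) = sumBelow f y + f y

sumBelow-cong : ∀ {f g} y → (∀ l → f l ≡ g l) → sumBelow f y ≡ sumBelow g y
sumBelow-cong zero f≗g = refl
sumBelow-cong (suc y) f≗g = cong₂ _+_ (sumBelow-cong y f≗g) (f≗g y)

≤-sumBelow : ∀ f {l y} → l < y → f l ≤ sumBelow f y
≤-sumBelow f {l} {suc y} l<1+y with m<1+n⇒m<n∨m≡n l<1+y
... | inj₁ l<y = ≤-trans (≤-sumBelow f l<y) (m≤m+n _ (f y))
... | inj₂ refl = m≤n+m (f l) _

sumBelow-zero : ∀ f y → (∀ l → l < y → f l ≡ 0) → sumBelow f y ≡ 0
sumBelow-zero f zero _ = refl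
sumBelow-zero f (suc y) f≡0 =
  cong₂ _+_ (sumBelow-zero f y (λ l l<y → f≡0 l (m<n⇒m<1+n l<y))) (f≡0 y ≤-refl)

sumBelow-nonzero : ∀ f y → sumBelow f y ≢ 0 → Σ ℕ λ l → l < y × f l ≢ 0
sumBelow-nonzero f zero sum≢0 = ⊥-elim (sum≢0 refl)
sumBelow-nonzero f (suc y) sum≢0 with f y ≟ 0
... | no fy≢0 = y , ≤-refl , fy≢0
... | yes fy≡0 =
  let l , l<y , fl≢0 = sumBelow-nonzero f y (λ s≡0 → sum≢0 (cong₂ _+_ s≡0 fy≡0))
  in l , m<n⇒m<1+n l<y , fl≢0

sumBelow-initialSegment : ∀ f x y → (∀ l → l < x → f l ≡ 1) → (∀ l → x ≤ l → f l ≡ 0) →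
                          sumBelow f y ≡ y ⊓ x
sumBelow-initialSegment f x zero _ _ = refl
sumBelow-initialSegment f x (suc y) inside outside with y <? x
... | yes y<x = begin
  sumBelow f y + f y ≡⟨ cong₂ _+_ (sumBelow-initialSegment f x y inside outside) (inside y y<x) ⟩
  y ⊓ x + 1          ≡⟨ cong (_+ 1) (m≤n⇒m⊓n≡m (<⇒≤ y<x)) ⟩
  y + 1              ≡⟨ +-comm y 1 ⟩
  suc y              ≡⟨ m≤n⇒m⊓n≡m y<x ⟨
  suc y ⊓ x          ∎
  where open ≡-Reasoning
... | no y≮x = begin
  sumBelow f y + f y ≡⟨ cong₂ _+_ (sumBelow-initialSegment f x y inside outside) (outside y x≤y) ⟩
  y ⊓ x + 0          ≡⟨ +-identityʳ _ ⟩
  y ⊓ x              ≡⟨ m≥n⇒m⊓n≡n x≤y ⟩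
  x                  ≡⟨ m≥n⇒m⊓n≡n (m≤n⇒m≤1+n x≤y) ⟨
  suc y ⊓ x          ∎
  where
  open ≡-Reasoning
  x≤y : x ≤ y
  x≤y = ≮⇒≥ y≮x

ifZero : ℕ → ℕ → ℕ → ℕ
ifZero zero a b = a
ifZero (suc _) a b = b

χ₀ : ℕ → ℕ
χ₀ n = ifZero n 1 0

χ≤ χ≡ : ℕ → ℕ → ℕ
χ≤ a b = χ₀ (a ∸ b)
χ≡ a b = χ₀ ∣ a - b ∣

χ₀≤1 : ∀ n → χ₀ n ≤ 1
χ₀≤1 zero = ≤-refl
χ₀≤1 (suc n) = z≤n

χ₀≢0⇒≡0 : ∀ n → χ₀ n ≢ 0 → n ≡ 0
χ₀≢0⇒≡0 zero _ = refl
χ₀≢0⇒≡0 (suc n) χ≢0 = ⊥-elim (χ≢0 refl)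

χ≤-≤ : ∀ {a b} → a ≤ b → χ≤ a b ≡ 1
χ≤-≤ a≤b = cong χ₀ (m≤n⇒m∸n≡0 a≤b)

χ≤-> : ∀ {a b} → b < a → χ≤ a b ≡ 0
χ≤-> {a} {b} b<a with a ∸ b in a∸b≡
... | zero = ⊥-elim (m>n⇒m∸n≢0 b<a a∸b≡)
... | suc _ = refl

χ≡-refl : ∀ a → χ≡ a a ≡ 1
χ≡-refl a = cong χ₀ (∣n-n∣≡0 a)

χ≡≢0⇒≡ : ∀ a b → χ≡ a b ≢ 0 → a ≡ b
χ≡≢0⇒≡ a b χ≢0 = ∣m-n∣≡0⇒m≡n (χ₀≢0⇒≡0 _ χ≢0)

χ≡≡1⇒≡ : ∀ a b → χ≡ a b ≡ 1 → a ≡ b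
χ≡≡1⇒≡ a b χ≡1 = χ≡≢0⇒≡ a b (λ χ≡0 → 1+n≢0 (trans (sym χ≡1) χ≡0))

∸+∸≡∣-∣ : ∀ a b → (a ∸ b) + (b ∸ a) ≡ ∣ a - b ∣
∸+∸≡∣-∣ zero zero = refl
∸+∸≡∣-∣ zero (suc b) = refl
∸+∸≡∣-∣ (suc a) zero = +-identityʳ (suc a)
∸+∸≡∣-∣ (suc a) (suc b) = ∸+∸≡∣-∣ a b

countBelow : ∀ (g : ℕ → ℕ) w x y → x ≤ y → (∀ l → l < x → g l ≤ w) → (∀ l → x ≤ l → w < g l) →
             sumBelow (λ l → χ≤ (g l) w) y ≡ x
countBelow g w x y x≤y below above =
  trans (sumBelow-initialSegment _ x y (λ l l<x → χ≤-≤ (below l l<x)) (λ l x≤l → χ≤-> (above l x≤l)))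
        (m≥n⇒m⊓n≡n x≤y)

l<⌊z/2⌋⇒[1+l]+[1+l]≤z : ∀ z l → l < ⌊ z /2⌋ → suc l + suc l ≤ z
l<⌊z/2⌋⇒[1+l]+[1+l]≤z (suc (suc z)) zero _ = s≤s (s≤s z≤n)
l<⌊z/2⌋⇒[1+l]+[1+l]≤z (suc (suc z)) (suc l) (s≤s l<) =
  s≤s (subst (_≤ suc z) (sym (+-suc (suc l) (suc l))) (s≤s (l<⌊z/2⌋⇒[1+l]+[1+l]≤z z l l<)))

⌊z/2⌋≤l⇒z<[1+l]+[1+l] : ∀ z l → ⌊ z /2⌋ ≤ l → z < suc l + suc l
⌊z/2⌋≤l⇒z<[1+l]+[1+l] zero l _ = s≤s z≤n
⌊z/2⌋≤l⇒z<[1+l]+[1+l] (suc zero) l _ = s≤s (subst (1 ≤_) (sym (+-suc l l)) (s≤s z≤n))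
⌊z/2⌋≤l⇒z<[1+l]+[1+l] (suc (suc z)) (suc l) (s≤s ⌊z/2⌋≤l) =
  s≤s (subst (suc (suc z) ≤_) (sym (+-suc (suc l) (suc l))) (s≤s (⌊z/2⌋≤l⇒z<[1+l]+[1+l] z l ⌊z/2⌋≤l)))

⌊/2⌋-count : ∀ z → sumBelow (λ l → χ≤ (suc l + suc l) z) z ≡ ⌊ z /2⌋
⌊/2⌋-count z = countBelow (λ l → suc l + suc l) z ⌊ z /2⌋ z (⌊n/2⌋≤n z) (l<⌊z/2⌋⇒[1+l]+[1+l]≤z z) (⌊z/2⌋≤l⇒z<[1+l]+[1+l] z)

join-even : ∀ a b z → join a b (z + z) ≡ a z
join-even a b zero = refl
join-even a b (suc z) = trans (cong (λ n → join a b (suc n)) (+-suc z z)) (join-even (λ i → a (suc i)) (λ i → b (suc i)) z)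

join-odd : ∀ a b z → join a b (suc (z + z)) ≡ b z
join-odd a b zero = refl
join-odd a b (suc z) = trans (cong (λ n → join a b (suc (suc n))) (+-suc z z)) (join-odd (λ i → a (suc i)) (λ i → b (suc i)) z)

join-⌊/2⌋ : ∀ a b z → join a b z ≡ ifZero (z ∸ (⌊ z /2⌋ + ⌊ z /2⌋)) (a ⌊ z /2⌋) (b ⌊ z /2⌋)
join-⌊/2⌋ a b zero = refl
join-⌊/2⌋ a b (suc zero) = refl
join-⌊/2⌋ a b (suc (suc z)) = trans (join-⌊/2⌋ (λ i → a (suc i)) (λ i → b (suc i)) z)
  (cong (λ d → ifZero (suc z ∸ d) (a (suc h)) (b (suc h))) (sym (+-suc h h)))
  where h = ⌊ z /2⌋

-- Cantor pairing

tri-mono-≤ : ∀ {a b} → a ≤ b → tri a ≤ tri b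
tri-mono-≤ {b = zero} z≤n = ≤-refl
tri-mono-≤ {zero} {suc b} _ = z≤n
tri-mono-≤ {suc a} {suc b} (s≤s a≤b) = +-mono-≤ (tri-mono-≤ a≤b) (s≤s a≤b)

n≤tri : ∀ n → n ≤ tri n
n≤tri zero = z≤n
n≤tri (suc n) = m≤n+m (suc n) (tri n)

sumBelow-suc≡tri : ∀ n → sumBelow suc n ≡ tri n
sumBelow-suc≡tri zero = refl
sumBelow-suc≡tri (suc n) = cong (_+ suc n) (sumBelow-suc≡tri n)

tri≤pair : ∀ n m → tri (n + m) ≤ pair n m
tri≤pair n m = m≤m+n (tri (n + m)) m

pair<tri : ∀ n m → pair n m < tri (suc (n + m))
pair<tri n m = subst (_≤ tri (suc (n + m))) (+-suc (tri (n + m)) m) (+-monoʳ-≤ (tri (n + m)) (s≤s (m≤n+m m n)))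

≤pair : ∀ n m → n ≤ pair n m
≤pair n m = ≤-trans (m≤m+n n m) (≤-trans (n≤tri (n + m)) (tri≤pair n m))

tri-interval-unique : ∀ {a b w} → tri a ≤ w → w < tri (suc a) → tri b ≤ w → w < tri (suc b) → a ≡ b
tri-interval-unique {a} {b} tri-a≤w w<tri-1+a tri-b≤w w<tri-1+b with <-cmp a b
... | tri< a<b _ _ = ⊥-elim (<⇒≱ w<tri-1+a (≤-trans (tri-mono-≤ a<b) tri-b≤w))
... | tri≈ _ a≡b _ = a≡b
... | tri> _ _ b<a = ⊥-elim (<⇒≱ w<tri-1+b (≤-trans (tri-mono-≤ b<a) tri-a≤w))

pair-injective : ∀ {n m n′ m′} → pair n m ≡ pair n′ m′ → n ≡ n′ × m ≡ m′
pair-injective {n} {m} {n′} {m′} eq = n≡n′ , m≡m′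
  where
  sums : n + m ≡ n′ + m′
  sums = tri-interval-unique (tri≤pair n m) (pair<tri n m)
           (subst (tri (n′ + m′) ≤_) (sym eq) (tri≤pair n′ m′))
           (subst (_< tri (suc (n′ + m′))) (sym eq) (pair<tri n′ m′))
  m≡m′ : m ≡ m′
  m≡m′ = +-cancelˡ-≡ (tri (n + m)) m m′ (trans eq (cong (λ s → tri s + m′) (sym sums)))
  n≡n′ : n ≡ n′
  n≡n′ = +-cancelʳ-≡ m n n′ (trans sums (cong (n′ +_) (sym m≡m′)))

nextPair : ℕ × ℕ → ℕ × ℕ
nextPair (zero , m) = suc m , 0
nextPair (suc n , m) = n , suc m

unpair : ℕ → ℕ × ℕ
unpair zero = 0 , 0
unpair (suc w) = nextPair (unpair w)

π₁ π₂ : ℕ → ℕ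
π₁ w = proj₁ (unpair w)
π₂ w = proj₂ (unpair w)

pair-nextPair : ∀ nm → pair (proj₁ (nextPair nm)) (proj₂ (nextPair nm)) ≡ suc (pair (proj₁ nm) (proj₂ nm))
pair-nextPair (zero , m) = begin
  tri (suc m + 0) + 0 ≡⟨ +-identityʳ _ ⟩
  tri (suc m + 0)     ≡⟨ cong (tri ∘ suc) (+-identityʳ m) ⟩
  tri m + suc m       ≡⟨ +-suc (tri m) m ⟩
  suc (tri m + m)     ∎
  where open ≡-Reasoning
pair-nextPair (suc n , m) = begin
  tri (n + suc m) + suc m     ≡⟨ cong (λ s → tri s + suc m) (+-suc n m) ⟩
  tri (suc (n + m)) + suc m   ≡⟨ +-suc (tri (suc (n + m))) m ⟩
  suc (tri (suc (n + m)) + m) ∎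
  where open ≡-Reasoning

pair-π : ∀ w → pair (π₁ w) (π₂ w) ≡ w
pair-π zero = refl
pair-π (suc w) = trans (pair-nextPair (unpair w)) (cong suc (pair-π w))

unpair-pair : ∀ n m → unpair (pair n m) ≡ (n , m)
unpair-pair n m with pair-injective (pair-π (pair n m))
... | π₁≡n , π₂≡m = cong₂ _,_ π₁≡n π₂≡m

π₁-pair : ∀ n m → π₁ (pair n m) ≡ n
π₁-pair n m = cong proj₁ (unpair-pair n m)

π₂-pair : ∀ n m → π₂ (pair n m) ≡ m
π₂-pair n m = cong proj₂ (unpair-pair n m)

π₁≤ : ∀ w → π₁ w ≤ w
π₁≤ w = subst (π₁ w ≤_) (pair-π w) (≤pair (π₁ w) (π₂ w))

π-injective : ∀ {w w′} → π₁ w ≡ π₁ w′ → π₂ w ≡ π₂ w′ → w ≡ w′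
π-injective {w} {w′} π₁≡ π₂≡ = trans (sym (pair-π w)) (trans (cong₂ pair π₁≡ π₂≡) (pair-π w′))

unpair-⤖ : ℕ ⤖ (ℕ × ℕ)
unpair-⤖ = ↔⇒⤖ (mk↔ₛ′ unpair (uncurry pair) (uncurry unpair-pair) pair-π)

diagonal-count : ∀ w → sumBelow (λ t → χ≤ (tri (suc t)) w) (suc w) ≡ π₁ w + π₂ w
diagonal-count w = countBelow (tri ∘ suc) w d (suc w) d≤1+w
  (λ t t<d → ≤-trans (tri-mono-≤ t<d) tri-d≤w)
  (λ t d≤t → <-≤-trans w<tri-1+d (tri-mono-≤ (s≤s d≤t)))
  where
  d = π₁ w + π₂ w
  tri-d≤w : tri d ≤ w
  tri-d≤w = subst (tri d ≤_) (pair-π w) (tri≤pair (π₁ w) (π₂ w))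
  w<tri-1+d : w < tri (suc d)
  w<tri-1+d = subst (_< tri (suc d)) (pair-π w) (pair<tri (π₁ w) (π₂ w))
  d≤1+w : d ≤ suc w
  d≤1+w = m≤n⇒m≤1+n (≤-trans (n≤tri d) tri-d≤w)

π₂-diagonal : ∀ w → w ∸ tri (π₁ w + π₂ w) ≡ π₂ w
π₂-diagonal w = trans (cong (_∸ tri (π₁ w + π₂ w)) (sym (pair-π w))) (m+n∸m≡n (tri (π₁ w + π₂ w)) (π₂ w))

module StrictlyIncreasing (f : ℕ → ℕ) (f<f∘suc : ∀ j → f j < f (suc j)) where

  mono-< : ∀ {i j} → i < j → f i < f j
  mono-< {i} {suc j} i<1+j with m<1+n⇒m<n∨m≡n i<1+j
  ... | inj₁ i<j = <-trans (mono-< i<j) (f<f∘suc j)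
  ... | inj₂ refl = f<f∘suc i

  mono-≤ : ∀ {i j} → i ≤ j → f i ≤ f j
  mono-≤ i≤j with m≤n⇒m<n∨m≡n i≤j
  ... | inj₁ i<j = <⇒≤ (mono-< i<j)
  ... | inj₂ refl = ≤-refl

  ≤f : ∀ j → j ≤ f j
  ≤f zero = z≤n
  ≤f (suc j) = ≤-trans (s≤s (≤f j)) (f<f∘suc j)

  reflects-< : ∀ {i j} → f i < f j → i < j
  reflects-< fi<fj = ≰⇒> (λ j≤i → <⇒≱ fi<fj (mono-≤ j≤i))

injective⇒unbounded : (h : ℕ → ℕ) → (∀ {a b} → h a ≡ h b → a ≡ b) → ∀ B → Σ ℕ λ t → B < h t
injective⇒unbounded h h-injective B with any? (λ (t : Fin (suc (suc B))) → B <? h (toℕ t))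
... | yes (t , B<ht) = toℕ t , B<ht
... | no none-above = ⊥-elim (<-irrefl refl (injective⇒≤ {f = restricted} restricted-injective))
  where
  restricted : Fin (suc (suc B)) → Fin (suc B)
  restricted t = fromℕ< (s≤s (≮⇒≥ (λ B<ht → none-above (t , B<ht))))
  restricted-injective : ∀ {s t} → restricted s ≡ restricted t → s ≡ t
  restricted-injective {s} {t} eq =
    toℕ-injective (h-injective (trans (sym (toℕ-fromℕ< _)) (trans (cong toℕ eq) (toℕ-fromℕ< _))))

least : ∀ {P : ℕ → Set} → U.Decidable P → ∀ {w} → P w → Σ ℕ λ y → P y × (∀ z → z < y → ¬ P z)
least {P} P? {w} Pw = search w 0 (λ _ ()) Pw
  where
  search : ∀ d b → (∀ z → z < b → ¬ P z) → P (b + d) → Σ ℕ λ y → P y × (∀ z → z < y → ¬ P z)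
  search d b none-below P[b+d] with P? b
  ... | yes Pb = b , Pb , none-below
  search zero b none-below P[b+0] | no ¬Pb = ⊥-elim (¬Pb (subst P (+-identityʳ b) P[b+0]))
  search (suc d) b none-below P[b+1+d] | no ¬Pb = search d (suc b) none-below′ (subst P (+-suc b d) P[b+1+d])
    where
    none-below′ : ∀ z → z < suc b → ¬ P z
    none-below′ z z<1+b with m<1+n⇒m<n∨m≡n z<1+b
    ... | inj₁ z<b = none-below z z<b
    ... | inj₂ refl = ¬Pb

-- Copies of 𝓔

IsoToE-resp-⇔ : ∀ {D : Set} {R S : D → D → Set} → (∀ u v → R u v ⇔ S u v) → IsoToE D R → IsoToE D S
IsoToE-resp-⇔ R⇔S (f , R⇔E) = f , λ u v → mk⇔
  (Equivalence.to (R⇔E u v) ∘ Equivalence.from (R⇔S u v))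
  (Equivalence.to (R⇔S u v) ∘ Equivalence.from (R⇔E u v))

module CopyOfE {D : Set} (κ : D → ℕ) (copy : IsoToE D (_≡_ on κ)) where

  private
    to : D → ℕ × ℕ
    to = Bijection.to (proj₁ copy)

    from : ℕ × ℕ → D
    from y = proj₁ (Bijection.surjective (proj₁ copy) y)

    to∘from : ∀ y → to (from y) ≡ y
    to∘from y = proj₂ (Bijection.surjective (proj₁ copy) y) refl

    κ≡⇒E : ∀ u v → κ u ≡ κ v → proj₁ (to u) ≡ proj₁ (to v)
    κ≡⇒E u v = Equivalence.to (proj₂ copy u v)

    E⇒κ≡ : ∀ u v → proj₁ (to u) ≡ proj₁ (to v) → κ u ≡ κ v
    E⇒κ≡ u v = Equivalence.from (proj₂ copy u v)

  classes-unbounded : ∀ B → Σ D λ u → B < κ u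
  classes-unbounded B =
    let t , B<κ = injective⇒unbounded (λ t → κ (from (t , 0))) representatives-injective B
    in from (t , 0) , B<κ
    where
    representatives-injective : ∀ {s t} → κ (from (s , 0)) ≡ κ (from (t , 0)) → s ≡ t
    representatives-injective {s} {t} eq =
      trans (cong proj₁ (sym (to∘from (s , 0)))) (trans (κ≡⇒E _ _ eq) (cong proj₁ (to∘from (t , 0))))

  class-unbounded : (ι : D → ℕ) → (∀ {u v} → κ u ≡ κ v → ι u ≡ ι v → u ≡ v) →
                    ∀ u B → Σ D λ v → κ v ≡ κ u × B < ι v
  class-unbounded ι κι-injective u B =
    let t , B<ι = injective⇒unbounded (λ t → ι (member t)) members-injective B
    in member t , member-class t , B<ι
    where
    a = proj₁ (to u)
    member : ℕ → D
    member t = from (a , t)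
    member-class : ∀ t → κ (member t) ≡ κ u
    member-class t = E⇒κ≡ (member t) u (cong proj₁ (to∘from (a , t)))
    members-injective : ∀ {s t} → ι (member s) ≡ ι (member t) → s ≡ t
    members-injective {s} {t} eq = cong proj₂ (begin
      (a , s)          ≡⟨ to∘from (a , s) ⟨
      to (member s)    ≡⟨ cong to (κι-injective (trans (member-class s) (sym (member-class t))) eq) ⟩
      to (member t)    ≡⟨ to∘from (a , t) ⟩
      (a , t)          ∎)
      where open ≡-Reasoning

-- Oracle computations

addC : Code 2
addC = prec (projC zero) (comp succC (projC (suc zero) ∷ []))

predC : Code 1
predC = prec zeroC (projC zero)

flippedMonusC : Code 2
flippedMonusC = prec (projC zero) (comp predC (projC (suc zero) ∷ []))

monusC : Code 2
monusC = comp flippedMonusC (projC (suc zero) ∷ projC zero ∷ [])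

litC : ∀ {n} → ℕ → Code n
litC zero = zeroC
litC (suc k) = comp succC (litC k ∷ [])

idsC : ∀ {n} → Vec (Code n) n
idsC = tabulate projC

drop2C : ∀ {n} → Vec (Code (suc (suc n))) n
drop2C = tabulate (λ i → projC (suc (suc i)))

module _ {f : Baire} where

  eval-add : ∀ y x → Eval f addC (y ∷ x ∷ []) (y + x)
  eval-add zero x = evPrec0 evProj
  eval-add (suc y) x = evPrecS (eval-add y x) (evComp (evProj ∷ []) evSucc)

  eval-pred : ∀ y → Eval f predC (y ∷ []) (pred y)
  eval-pred zero = evPrec0 evZero
  eval-pred (suc y) = evPrecS (eval-pred y) evProj

  eval-flippedMonus : ∀ b a → Eval f flippedMonusC (b ∷ a ∷ []) (a ∸ b)
  eval-flippedMonus zero a = evPrec0 evProj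
  eval-flippedMonus (suc b) a = evPrecS (eval-flippedMonus b a)
    (subst (Eval f _ _) (pred[m∸n]≡m∸[1+n] a b) (evComp (evProj ∷ []) (eval-pred (a ∸ b))))

  eval-monus : ∀ a b → Eval f monusC (a ∷ b ∷ []) (a ∸ b)
  eval-monus a b = evComp (evProj ∷ evProj ∷ []) (eval-flippedMonus b a)

  eval-lit : ∀ {n} k (xs : Vec ℕ n) → Eval f (litC k) xs k
  eval-lit zero xs = evZero
  eval-lit (suc k) xs = evComp (eval-lit k xs ∷ []) evSucc

  evalAll-projections : ∀ {m n} (ρ : Fin m → Fin n) (xs : Vec ℕ n) →
                        EvalAll f (tabulate (projC ∘ ρ)) xs (tabulate (lookup xs ∘ ρ))
  evalAll-projections {zero} ρ xs = []
  evalAll-projections {suc m} ρ xs = evProj ∷ evalAll-projections (ρ ∘ suc) xs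

  evalAll-ids : ∀ {n} (xs : Vec ℕ n) → EvalAll f idsC xs xs
  evalAll-ids xs = subst (EvalAll f idsC xs) (tabulate∘lookup xs) (evalAll-projections (λ i → i) xs)

  evalAll-drop2 : ∀ {n} a b (xs : Vec ℕ n) → EvalAll f drop2C (a ∷ b ∷ xs) xs
  evalAll-drop2 a b xs =
    subst (EvalAll f drop2C (a ∷ b ∷ xs)) (tabulate∘lookup xs) (evalAll-projections (λ i → suc (suc i)) (a ∷ b ∷ xs))

  mu-halts : ∀ {n} (c : Code (suc n)) (xs : Vec ℕ n) (F : ℕ → ℕ) → (∀ y → Eval f c (y ∷ xs) (F y)) →
             ∀ {w} → F w ≡ 0 → Σ ℕ λ y → Eval f (mu c) xs y × F y ≡ 0
  mu-halts c xs F c-computes-F Fw≡0 =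
    let y , Fy≡0 , none-below = least (λ y → F y ≟ 0) Fw≡0
    in y , evMu (subst (Eval f c (y ∷ xs)) Fy≡0 (c-computes-F y)) (λ z z<y → positive z (none-below z z<y)) , Fy≡0
    where
    positive : ∀ z → F z ≢ 0 → Σ ℕ λ v → Eval f c (z ∷ xs) (suc v)
    positive z Fz≢0 with F z | c-computes-F z
    ... | zero | _ = ⊥-elim (Fz≢0 refl)
    ... | suc v | eval = v , eval

infixl 6 _+ᵗ_ _∸ᵗ_

data Term (n : ℕ) : Set where
  var : Fin n → Term n
  lit : ℕ → Term n
  _+ᵗ_ _∸ᵗ_ : Term n → Term n → Term n
  query call : Term n → Term n
  app : Term 1 → Term n → Term n
  sumᵗ : Term (suc n) → Term n → Term n
  ifZeroᵗ : Term n → Term n → Term n → Term n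

record Env : Set where
  constructor env
  field
    oracleFn callFn : ℕ → ℕ
open Env

⟦_⟧ : ∀ {n} → Term n → Env → Vec ℕ n → ℕ
⟦ var i ⟧ ρ xs = lookup xs i
⟦ lit k ⟧ ρ xs = k
⟦ a +ᵗ b ⟧ ρ xs = ⟦ a ⟧ ρ xs + ⟦ b ⟧ ρ xs
⟦ a ∸ᵗ b ⟧ ρ xs = ⟦ a ⟧ ρ xs ∸ ⟦ b ⟧ ρ xs
⟦ query a ⟧ ρ xs = oracleFn ρ (⟦ a ⟧ ρ xs)
⟦ call a ⟧ ρ xs = callFn ρ (⟦ a ⟧ ρ xs)
⟦ app t a ⟧ ρ xs = ⟦ t ⟧ ρ (⟦ a ⟧ ρ xs ∷ [])
⟦ sumᵗ b e ⟧ ρ xs = sumBelow (λ l → ⟦ b ⟧ ρ (l ∷ xs)) (⟦ e ⟧ ρ xs)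
⟦ ifZeroᵗ c a b ⟧ ρ xs = ifZero (⟦ c ⟧ ρ xs) (⟦ a ⟧ ρ xs) (⟦ b ⟧ ρ xs)

compile : ∀ {n} → Code 1 → Term n → Code n
compile sub (var i) = projC i
compile sub (lit k) = litC k
compile sub (a +ᵗ b) = comp addC (compile sub a ∷ compile sub b ∷ [])
compile sub (a ∸ᵗ b) = comp monusC (compile sub a ∷ compile sub b ∷ [])
compile sub (query a) = comp oracle (compile sub a ∷ [])
compile sub (call a) = comp sub (compile sub a ∷ [])
compile sub (app t a) = comp (compile sub t) (compile sub a ∷ [])
compile sub (sumᵗ b e) =
  comp (prec zeroC (comp addC (projC (suc zero) ∷ comp (compile sub b) (projC zero ∷ drop2C) ∷ [])))
       (compile sub e ∷ idsC)
compile sub (ifZeroᵗ c a b) = comp (prec (compile sub a) (comp (compile sub b) drop2C)) (compile sub c ∷ idsC)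

module _ (sub : Code 1) (ρ : Env) (sub-computes : ∀ a → Eval (oracleFn ρ) sub (a ∷ []) (callFn ρ a)) where

  compile-sound : ∀ {n} (e : Term n) xs → Eval (oracleFn ρ) (compile sub e) xs (⟦ e ⟧ ρ xs)
  compile-sound (var i) xs = evProj
  compile-sound (lit k) xs = eval-lit k xs
  compile-sound (a +ᵗ b) xs = evComp (compile-sound a xs ∷ compile-sound b xs ∷ []) (eval-add _ _)
  compile-sound (a ∸ᵗ b) xs = evComp (compile-sound a xs ∷ compile-sound b xs ∷ []) (eval-monus _ _)
  compile-sound (query a) xs = evComp (compile-sound a xs ∷ []) evOrac
  compile-sound (call a) xs = evComp (compile-sound a xs ∷ []) (sub-computes _)
  compile-sound (app t a) xs = evComp (compile-sound a xs ∷ []) (compile-sound t _)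
  compile-sound (sumᵗ b e) xs = evComp (compile-sound e xs ∷ evalAll-ids xs) (partialSums (⟦ e ⟧ ρ xs))
    where
    partialSums : ∀ y → Eval (oracleFn ρ) _ (y ∷ xs) (sumBelow (λ l → ⟦ b ⟧ ρ (l ∷ xs)) y)
    partialSums zero = evPrec0 evZero
    partialSums (suc y) = evPrecS (partialSums y)
      (evComp (evProj ∷ evComp (evProj ∷ evalAll-drop2 _ _ xs) (compile-sound b (y ∷ xs)) ∷ []) (eval-add _ _))
  compile-sound (ifZeroᵗ c a b) xs = evComp (compile-sound c xs ∷ evalAll-ids xs) (branch (⟦ c ⟧ ρ xs))
    where
    branch : ∀ y → Eval (oracleFn ρ) _ (y ∷ xs) (ifZero y (⟦ a ⟧ ρ xs) (⟦ b ⟧ ρ xs))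
    branch zero = evPrec0 (compile-sound a xs)
    branch (suc y) = evPrecS (branch y) (evComp (evalAll-drop2 _ _ xs) (compile-sound b xs))

-- For terms without call: the dummy subroutine zeroC is never invoked.
compile₀ : ∀ {n} → Term n → Code n
compile₀ = compile zeroC

compile₀-sound : ∀ {n} f (e : Term n) xs → Eval f (compile₀ e) xs (⟦ e ⟧ (env f (λ _ → 0)) xs)
compile₀-sound f = compile-sound zeroC (env f (λ _ → 0)) (λ _ → evZero)

χ₀ᵗ : ∀ {n} → Term n → Term n
χ₀ᵗ e = ifZeroᵗ e (lit 1) (lit 0)

distᵗ : ∀ {n} → Term n → Term n → Term n
distᵗ a b = (a ∸ᵗ b) +ᵗ (b ∸ᵗ a)

triᵗ : ∀ {n} → Term n → Term n
triᵗ e = sumᵗ (lit 1 +ᵗ var zero) e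

pairᵗ : ∀ {n} → Term n → Term n → Term n
pairᵗ a b = triᵗ (a +ᵗ b) +ᵗ b

halfᵗ diagonalᵗ π₁ᵗ π₂ᵗ : ∀ {n} → Term n → Term n
halfᵗ = app (sumᵗ (χ₀ᵗ (((lit 1 +ᵗ var zero) +ᵗ (lit 1 +ᵗ var zero)) ∸ᵗ var (suc zero))) (var zero))
diagonalᵗ = app (sumᵗ (χ₀ᵗ (triᵗ (lit 1 +ᵗ var zero) ∸ᵗ var (suc zero))) (lit 1 +ᵗ var zero))
π₂ᵗ = app (var zero ∸ᵗ triᵗ (diagonalᵗ (var zero)))
π₁ᵗ = app (diagonalᵗ (var zero) ∸ᵗ π₂ᵗ (var zero))

module _ (ρ : Env) where

  distᵗ-sem : ∀ {n} (a b : Term n) xs → ⟦ distᵗ a b ⟧ ρ xs ≡ ∣ ⟦ a ⟧ ρ xs - ⟦ b ⟧ ρ xs ∣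
  distᵗ-sem a b xs = ∸+∸≡∣-∣ (⟦ a ⟧ ρ xs) (⟦ b ⟧ ρ xs)

  triᵗ-sem : ∀ {n} (e : Term n) xs → ⟦ triᵗ e ⟧ ρ xs ≡ tri (⟦ e ⟧ ρ xs)
  triᵗ-sem e xs = sumBelow-suc≡tri (⟦ e ⟧ ρ xs)

  pairᵗ-sem : ∀ {n} (a b : Term n) xs → ⟦ pairᵗ a b ⟧ ρ xs ≡ pair (⟦ a ⟧ ρ xs) (⟦ b ⟧ ρ xs)
  pairᵗ-sem a b xs = cong (_+ ⟦ b ⟧ ρ xs) (triᵗ-sem (a +ᵗ b) xs)

  halfᵗ-sem : ∀ {n} (e : Term n) xs → ⟦ halfᵗ e ⟧ ρ xs ≡ ⌊ ⟦ e ⟧ ρ xs /2⌋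
  halfᵗ-sem e xs = ⌊/2⌋-count (⟦ e ⟧ ρ xs)

  diagonalᵗ-sem : ∀ {n} (e : Term n) xs → ⟦ diagonalᵗ e ⟧ ρ xs ≡ π₁ (⟦ e ⟧ ρ xs) + π₂ (⟦ e ⟧ ρ xs)
  diagonalᵗ-sem e xs = trans
    (sumBelow-cong (suc w) (λ t → cong (λ v → χ₀ (v ∸ w)) (sumBelow-suc≡tri (suc t)))) (diagonal-count w)
    where w = ⟦ e ⟧ ρ xs

  π₂ᵗ-sem : ∀ {n} (e : Term n) xs → ⟦ π₂ᵗ e ⟧ ρ xs ≡ π₂ (⟦ e ⟧ ρ xs)
  π₂ᵗ-sem e xs = trans (cong (λ d → w ∸ sumBelow suc d) (diagonalᵗ-sem (var zero) (w ∷ [])))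
                       (trans (cong (w ∸_) (sumBelow-suc≡tri (π₁ w + π₂ w))) (π₂-diagonal w))
    where w = ⟦ e ⟧ ρ xs

  π₁ᵗ-sem : ∀ {n} (e : Term n) xs → ⟦ π₁ᵗ e ⟧ ρ xs ≡ π₁ (⟦ e ⟧ ρ xs)
  π₁ᵗ-sem e xs = trans (cong₂ _∸_ (diagonalᵗ-sem (var zero) (w ∷ [])) (π₂ᵗ-sem (var zero) (w ∷ [])))
                       (m+n∸n≡m (π₁ w) (π₂ w))
    where w = ⟦ e ⟧ ρ xs

-- The forward functional

sameClass : ℕ → ℕ
sameClass z = χ≡ (π₁ (π₁ z)) (π₁ (π₂ z))

colourIndex : ℕ → ℕ
colourIndex x = pair (π₁ x) (suc (π₁ x + π₂ x))

presentation : Baire → Baire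
presentation c = join sameClass (c ∘ colourIndex)

sameClassᵗ colourIndexᵗ : ∀ {n} → Term n → Term n
sameClassᵗ = app (χ₀ᵗ (distᵗ (π₁ᵗ (π₁ᵗ (var zero))) (π₁ᵗ (π₂ᵗ (var zero)))))
colourIndexᵗ = app (pairᵗ (π₁ᵗ (var zero)) (lit 1 +ᵗ (π₁ᵗ (var zero) +ᵗ π₂ᵗ (var zero))))

Δᵗ : Term 1
Δᵗ = ifZeroᵗ (var zero ∸ᵗ (half +ᵗ half)) (sameClassᵗ half) (query (colourIndexᵗ half))
  where
  half : Term 1
  half = halfᵗ (var zero)

ΔC : TuringFunctional
ΔC = compile₀ Δᵗ

module _ (ρ : Env) where

  sameClassᵗ-sem : ∀ {n} (e : Term n) xs → ⟦ sameClassᵗ e ⟧ ρ xs ≡ sameClass (⟦ e ⟧ ρ xs)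
  sameClassᵗ-sem e xs = cong χ₀ (trans (distᵗ-sem ρ (π₁ᵗ (π₁ᵗ z)) (π₁ᵗ (π₂ᵗ z)) (w ∷ []))
    (cong₂ ∣_-_∣ (trans (π₁ᵗ-sem ρ (π₁ᵗ z) (w ∷ [])) (cong π₁ (π₁ᵗ-sem ρ z (w ∷ []))))
                 (trans (π₁ᵗ-sem ρ (π₂ᵗ z) (w ∷ [])) (cong π₁ (π₂ᵗ-sem ρ z (w ∷ []))))))
    where
    z : Term 1
    z = var zero
    w = ⟦ e ⟧ ρ xs

  colourIndexᵗ-sem : ∀ {n} (e : Term n) xs → ⟦ colourIndexᵗ e ⟧ ρ xs ≡ colourIndex (⟦ e ⟧ ρ xs)
  colourIndexᵗ-sem e xs = trans (pairᵗ-sem ρ (π₁ᵗ z) (lit 1 +ᵗ (π₁ᵗ z +ᵗ π₂ᵗ z)) (w ∷ []))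
    (cong₂ pair (π₁ᵗ-sem ρ z (w ∷ [])) (cong suc (cong₂ _+_ (π₁ᵗ-sem ρ z (w ∷ [])) (π₂ᵗ-sem ρ z (w ∷ [])))))
    where
    z : Term 1
    z = var zero
    w = ⟦ e ⟧ ρ xs

Δᵗ-sem : ∀ c g z → ⟦ Δᵗ ⟧ (env c g) (z ∷ []) ≡ presentation c z
Δᵗ-sem c g z = begin
  branch (⟦ halfᵗ (var zero) ⟧ ρ (z ∷ []))                ≡⟨ cong branch (halfᵗ-sem ρ (var zero) (z ∷ [])) ⟩
  branch h                                                 ≡⟨ cong₂ (ifZero (z ∸ (h + h)))
                                                                (sameClassᵗ-sem ρ (var zero) (h ∷ []))
                                                                (cong c (colourIndexᵗ-sem ρ (var zero) (h ∷ []))) ⟩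
  ifZero (z ∸ (h + h)) (sameClass h) (c (colourIndex h))  ≡⟨ join-⌊/2⌋ sameClass (c ∘ colourIndex) z ⟨
  presentation c z                                         ∎
  where
  open ≡-Reasoning
  ρ = env c g
  h = ⌊ z /2⌋
  branch : ℕ → ℕ
  branch v = ifZero (z ∸ (v + v)) (⟦ sameClassᵗ (var zero) ⟧ ρ (v ∷ [])) (c (⟦ colourIndexᵗ (var zero) ⟧ ρ (v ∷ [])))

ΔC-computes : ∀ c → ΔC ^ c ≃ presentation c
ΔC-computes c z = subst (Eval c ΔC (z ∷ [])) (Δᵗ-sem c (λ _ → 0) z) (compile₀-sound c Δᵗ (z ∷ []))

evenPart-presentation : ∀ c x y → evenPart (presentation c) (pair x y) ≡ χ≡ (π₁ x) (π₁ y)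
evenPart-presentation c x y =
  trans (join-even sameClass _ (pair x y)) (cong₂ (λ a b → χ≡ (π₁ a) (π₁ b)) (π₁-pair x y) (π₂-pair x y))

presentation-related : ∀ c x y → RelOf (evenPart (presentation c)) x y ⇔ (π₁ x ≡ π₁ y)
presentation-related c x y = mk⇔
  (λ related → χ≡≡1⇒≡ _ _ (trans (sym (evenPart-presentation c x y)) related))
  (λ π₁≡ → trans (evenPart-presentation c x y) (subst (λ v → χ≡ (π₁ x) v ≡ 1) π₁≡ (χ≡-refl (π₁ x))))

oddPart-presentation : ∀ c x → oddPart (presentation c) x ≡ c (colourIndex x)
oddPart-presentation c = join-odd sameClass (c ∘ colourIndex)

presentation-dom : ∀ {k} c → dom (SRT2 k) c → dom (IndE k) (presentation c)
presentation-dom {k} c (c<k , _) =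
  (λ z → subst (_≤ 1) (sym (join-even sameClass _ z)) (χ₀≤1 _)) ,
  (unpair-⤖ , presentation-related c) ,
  (λ x → subst (_< k) (sym (oddPart-presentation c x)) (c<k _ _ (s≤s (m≤m+n (π₁ x) (π₂ x)))))

-- The backward functional

evenᵗ oddᵗ : ∀ {n} → Term n → Term n
evenᵗ e = query (e +ᵗ e)
oddᵗ e = query (lit 1 +ᵗ (e +ᵗ e))

module _ (c q g : Baire) where

  evenᵗ-sem : ∀ {n} (e : Term n) xs → ⟦ evenᵗ e ⟧ (env (join c q) g) xs ≡ c (⟦ e ⟧ (env (join c q) g) xs)
  evenᵗ-sem e xs = join-even c q _

  oddᵗ-sem : ∀ {n} (e : Term n) xs → ⟦ oddᵗ e ⟧ (env (join c q) g) xs ≡ q (⟦ e ⟧ (env (join c q) g) xs)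
  oddᵗ-sem e xs = join-odd c q _

record Extends (c q : Baire) (u x : ℕ) : Set where
  field
    member : q x ≡ 1
    beyond : u < π₁ x
    coloured : ∀ x′ → x′ ≤ u → q x′ ≡ 1 → c (pair (π₁ x′) (π₁ x)) ≡ c (colourIndex x′)

violation : Baire → Baire → ℕ → ℕ → ℕ
violation c q x x′ = ifZero ∣ q x′ - 1 ∣ ∣ c (pair (π₁ x′) (π₁ x)) - c (colourIndex x′) ∣ 0

cost : Baire → Baire → ℕ → ℕ → ℕ
cost c q x u = ∣ q x - 1 ∣ + (suc u ∸ π₁ x) + sumBelow (violation c q x) (suc u)

Extends⇒cost≡0 : ∀ {c q u x} → Extends c q u x → cost c q x u ≡ 0
Extends⇒cost≡0 {c} {q} {u} {x} ext = cong₂ _+_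
  (cong₂ _+_ (cong ∣_- 1 ∣ (Extends.member ext)) (m≤n⇒m∸n≡0 (Extends.beyond ext)))
  (sumBelow-zero (violation c q x) (suc u) (λ x′ x′<1+u → no-violation x′ (≤-pred x′<1+u)))
  where
  no-violation : ∀ x′ → x′ ≤ u → violation c q x x′ ≡ 0
  no-violation x′ x′≤u with ∣ q x′ - 1 ∣ in q-dist
  ... | zero = m≡n⇒∣m-n∣≡0 (Extends.coloured ext x′ x′≤u (∣m-n∣≡0⇒m≡n q-dist))
  ... | suc _ = refl

cost≡0⇒Extends : ∀ {c q u x} → cost c q x u ≡ 0 → Extends c q u x
cost≡0⇒Extends {c} {q} {u} {x} cost≡0 = record
  { member = ∣m-n∣≡0⇒m≡n (m+n≡0⇒m≡0 _ head≡0)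
  ; beyond = m∸n≡0⇒m≤n (m+n≡0⇒n≡0 ∣ q x - 1 ∣ head≡0)
  ; coloured = coloured
  }
  where
  head≡0 : ∣ q x - 1 ∣ + (suc u ∸ π₁ x) ≡ 0
  head≡0 = m+n≡0⇒m≡0 _ cost≡0
  violations≡0 : sumBelow (violation c q x) (suc u) ≡ 0
  violations≡0 = m+n≡0⇒n≡0 (∣ q x - 1 ∣ + (suc u ∸ π₁ x)) cost≡0
  coloured : ∀ x′ → x′ ≤ u → q x′ ≡ 1 → c (pair (π₁ x′) (π₁ x)) ≡ c (colourIndex x′)
  coloured x′ x′≤u qx′≡1 = ∣m-n∣≡0⇒m≡n
    (subst (λ v → ifZero ∣ v - 1 ∣ ∣ c (pair (π₁ x′) (π₁ x)) - c (colourIndex x′) ∣ 0 ≡ 0) qx′≡1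
      (n≤0⇒n≡0 (subst (violation c q x x′ ≤_) violations≡0 (≤-sumBelow (violation c q x) (s≤s x′≤u)))))

costᵗ : Term 2
costᵗ = distᵗ (oddᵗ x) (lit 1) +ᵗ ((lit 1 +ᵗ u) ∸ᵗ π₁ᵗ x) +ᵗ sumᵗ violationᵗ (lit 1 +ᵗ u)
  where
  x u : Term 2
  x = var zero
  u = var (suc zero)
  violationᵗ : Term 3
  violationᵗ = ifZeroᵗ (distᵗ (oddᵗ x′) (lit 1))
                       (distᵗ (evenᵗ (pairᵗ (π₁ᵗ x′) (π₁ᵗ (var (suc zero))))) (evenᵗ (colourIndexᵗ x′)))
                       (lit 0)
    where
    x′ : Term 3
    x′ = var zero

costᵗ-sem : ∀ c q g x u → ⟦ costᵗ ⟧ (env (join c q) g) (x ∷ u ∷ []) ≡ cost c q x u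
costᵗ-sem c q g x u = cong₂ _+_
  (cong₂ _+_ (member-sem (var zero) (x ∷ u ∷ [])) (cong (suc u ∸_) (π₁ᵗ-sem ρ (var zero) (x ∷ u ∷ []))))
  (sumBelow-cong (suc u) violation-sem)
  where
  ρ = env (join c q) g
  member-sem : ∀ {n} (e : Term n) xs → ⟦ distᵗ (oddᵗ e) (lit 1) ⟧ ρ xs ≡ ∣ q (⟦ e ⟧ ρ xs) - 1 ∣
  member-sem e xs = trans (distᵗ-sem ρ (oddᵗ e) (lit 1) xs) (cong ∣_- 1 ∣ (oddᵗ-sem c q g e xs))
  violation-sem : ∀ x′ → _ ≡ violation c q x x′
  violation-sem x′ = cong₂ (λ a b → ifZero a b 0) (member-sem (var zero) xs)
    (trans (distᵗ-sem ρ (evenᵗ (pairᵗ (π₁ᵗ (var zero)) (π₁ᵗ (var (suc zero))))) (evenᵗ (colourIndexᵗ (var zero))) xs)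
      (cong₂ ∣_-_∣
        (trans (evenᵗ-sem c q g (pairᵗ (π₁ᵗ (var zero)) (π₁ᵗ (var (suc zero)))) xs) (cong c (trans (pairᵗ-sem ρ (π₁ᵗ (var zero)) (π₁ᵗ (var (suc zero))) xs)
          (cong₂ pair (π₁ᵗ-sem ρ (var zero) xs) (π₁ᵗ-sem ρ (var (suc zero)) xs)))))
        (trans (evenᵗ-sem c q g (colourIndexᵗ (var zero)) xs) (cong c (colourIndexᵗ-sem ρ (var zero) xs)))))
    where
    xs = x′ ∷ x ∷ u ∷ []

image : (ℕ → ℕ) → Baire
image F z = ifZero (sumBelow (λ l → χ≡ (F l) z) (suc z)) 0 1

image-IsChar : ∀ F → IsChar (image F)
image-IsChar F z with sumBelow (λ l → χ≡ (F l) z) (suc z)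
... | zero = z≤n
... | suc _ = ≤-refl

image≡1⇒ : ∀ F z → image F z ≡ 1 → Σ ℕ λ l → F l ≡ z
image≡1⇒ F z z∈ with sumBelow (λ l → χ≡ (F l) z) (suc z) in sum≡ | z∈
... | suc _ | _ =
  let l , _ , χ≢0 = sumBelow-nonzero (λ l → χ≡ (F l) z) (suc z) (λ sum≡0 → 1+n≢0 (trans (sym sum≡) sum≡0))
  in l , χ≡≢0⇒≡ (F l) z χ≢0

image-∋ : ∀ F → (∀ l → l ≤ F l) → ∀ l → image F (F l) ≡ 1
image-∋ F l≤F l with sumBelow (λ l′ → χ≡ (F l′) (F l)) (suc (F l)) in sum≡
... | suc _ = refl
... | zero = ⊥-elim (<-irrefl refl (subst (1 ≤_) sum≡
               (subst (_≤ sumBelow (λ l′ → χ≡ (F l′) (F l)) (suc (F l))) (χ≡-refl (F l)) (≤-sumBelow (λ l′ → χ≡ (F l′) (F l)) (s≤s (l≤F l))))))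

stepC : Code 2
stepC = comp (mu (compile₀ costᵗ)) (projC (suc zero) ∷ [])

sequenceC : Code 1
sequenceC = prec zeroC stepC

Ψᵗ : Term 1
Ψᵗ = ifZeroᵗ (sumᵗ (χ₀ᵗ (distᵗ (π₁ᵗ (call (lit 1 +ᵗ var zero))) (var (suc zero)))) (lit 1 +ᵗ var zero)) (lit 0) (lit 1)

ΨC : TuringFunctional
ΨC = compile sequenceC Ψᵗ

Ψᵗ-sem : ∀ f s z → ⟦ Ψᵗ ⟧ (env f s) (z ∷ []) ≡ image (λ l → π₁ (s (suc l))) z
Ψᵗ-sem f s z = cong (λ v → ifZero v 0 1) (sumBelow-cong (suc z) (λ l →
  cong χ₀ (trans (distᵗ-sem ρ (π₁ᵗ (call (lit 1 +ᵗ var zero))) (var (suc zero)) (l ∷ z ∷ []))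
                 (cong ∣_- z ∣ (π₁ᵗ-sem ρ (call (lit 1 +ᵗ var zero)) (l ∷ z ∷ []))))))
  where
  ρ = env f s

Stable : Baire → Set
Stable c = ∀ n → Σ ℕ λ i → Σ ℕ λ s → ∀ m → m > s → c (pair n m) ≡ i

Members : Baire → Set
Members q = Σ ℕ λ x → q x ≡ 1

module Decoding (c : Baire) (stable : Stable c) (q : Baire) (i : ℕ)
                (monochromatic : ∀ x → q x ≡ 1 → c (colourIndex x) ≡ i)
                (copy : IsoToE (Members q) (_≡_ on (π₁ ∘ proj₁))) where

  open CopyOfE (π₁ ∘ proj₁) copy

  limit threshold : ℕ → ℕ
  limit n = proj₁ (stable n)
  threshold n = proj₁ (proj₂ (stable n))

  stabilises : ∀ n m → threshold n < m → c (pair n m) ≡ limit n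
  stabilises n = proj₂ (proj₂ (stable n))

  members-≡ : ∀ {u v : Members q} → proj₁ u ≡ proj₁ v → u ≡ v
  members-≡ {x , _} {.x , _} refl = cong (x ,_) (≡-irrelevant _ _)

  late-colour : ∀ x → q x ≡ 1 → ∀ m → threshold (π₁ x) < m → c (pair (π₁ x) m) ≡ i
  late-colour x qx≡1 m threshold<m =
    via-late-member (class-unbounded (π₂ ∘ proj₁) (λ π₁≡ π₂≡ → members-≡ (π-injective π₁≡ π₂≡)) (x , qx≡1) (threshold n))
    where
    n = π₁ x
    via-late-member : Σ (Members q) (λ v → π₁ (proj₁ v) ≡ n × threshold n < π₂ (proj₁ v)) → c (pair n m) ≡ i
    via-late-member ((v , qv≡1) , same-class , threshold<π₂v) = begin
      c (pair n m)                  ≡⟨ stabilises n m threshold<m ⟩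
      limit n                       ≡⟨ stabilises n (suc (n + π₂ v)) (≤-trans threshold<π₂v (m≤n⇒m≤1+n (m≤n+m (π₂ v) n))) ⟨
      c (pair n (suc (n + π₂ v)))   ≡⟨ cong (λ n′ → c (pair n′ (suc (n′ + π₂ v)))) same-class ⟨
      c (colourIndex v)             ≡⟨ monochromatic v qv≡1 ⟩
      i                             ∎
      where open ≡-Reasoning

  extension-exists : ∀ u → Σ ℕ (Extends c q u)
  extension-exists u = via-far-member (classes-unbounded bound)
    where
    bound = u + sumBelow (threshold ∘ π₁) (suc u)
    via-far-member : Σ (Members q) (λ v → bound < π₁ (proj₁ v)) → Σ ℕ (Extends c q u)
    via-far-member ((x , qx≡1) , bound<π₁x) = x , record
      { member = qx≡1
      ; beyond = ≤-<-trans (m≤m+n u _) bound<π₁x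
      ; coloured = λ x′ x′≤u qx′≡1 → trans
          (late-colour x′ qx′≡1 (π₁ x)
            (≤-<-trans (≤-trans (≤-sumBelow (threshold ∘ π₁) (s≤s x′≤u)) (m≤n+m _ u)) bound<π₁x))
          (sym (monochromatic x′ qx′≡1))
      }

  cost-computed : ∀ x u → Eval (join c q) (compile₀ costᵗ) (x ∷ u ∷ []) (cost c q x u)
  cost-computed x u =
    subst (Eval (join c q) _ _) (costᵗ-sem c q (λ _ → 0) x u) (compile₀-sound (join c q) costᵗ (x ∷ u ∷ []))

  -- Opaque: unfolding the μ-search makes later conversion checks prohibitively slow.
  opaque
    next : ∀ u → Σ ℕ λ x → Eval (join c q) (mu (compile₀ costᵗ)) (u ∷ []) x × cost c q x u ≡ 0
    next u = mu-halts (compile₀ costᵗ) (u ∷ []) (λ x → cost c q x u) (λ x → cost-computed x u)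
                      (Extends⇒cost≡0 (proj₂ (extension-exists u)))

  sequence : ℕ → ℕ
  sequence zero = 0
  sequence (suc j) = proj₁ (next (sequence j))

  sequenceC-computes : ∀ j → Eval (join c q) sequenceC (j ∷ []) (sequence j)
  sequenceC-computes zero = evPrec0 evZero
  sequenceC-computes (suc j) =
    evPrecS (sequenceC-computes j) (evComp (evProj ∷ []) (proj₁ (proj₂ (next (sequence j)))))

  sequence-extends : ∀ j → Extends c q (sequence j) (sequence (suc j))
  sequence-extends j = cost≡0⇒Extends (proj₂ (proj₂ (next (sequence j))))

  elements : ℕ → ℕ
  elements l = π₁ (sequence (suc l))

  sequence-increasing : ∀ j → sequence j < sequence (suc j)
  sequence-increasing j = <-≤-trans (Extends.beyond (sequence-extends j)) (π₁≤ _)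

  elements-increasing : ∀ l → elements l < elements (suc l)
  elements-increasing l = ≤-<-trans (π₁≤ _) (Extends.beyond (sequence-extends (suc l)))

  module Seq = StrictlyIncreasing sequence sequence-increasing
  module Elem = StrictlyIncreasing elements elements-increasing

  homogeneous : ∀ x y → x < y → image elements x ≡ 1 → image elements y ≡ 1 → c (pair x y) ≡ i
  homogeneous x y x<y x∈ y∈ with image≡1⇒ elements x x∈ | image≡1⇒ elements y y∈
  ... | l , refl | l′ , refl = trans
    (Extends.coloured (sequence-extends l′) (sequence (suc l)) (Seq.mono-≤ {suc l} {l′} (Elem.reflects-< x<y)) member)
    (monochromatic (sequence (suc l)) member)
    where
    member = Extends.member (sequence-extends l)

  solution : ∀ {k} → sol (SRT2 k) c (image elements)
  solution = image-IsChar elements , (λ N → elements N , Elem.≤f N , image-∋ elements Elem.≤f N) , i , homogeneous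

  ΨC-computes : ΨC ^ join c q ≃ image elements
  ΨC-computes z = subst (Eval (join c q) ΨC (z ∷ [])) (Ψᵗ-sem (join c q) sequence z)
    (compile-sound sequenceC (env (join c q) sequence) sequenceC-computes Ψᵗ (z ∷ []))

decode : ∀ {k} c → dom (SRT2 k) c → ∀ q → sol (IndE k) (presentation c) q →
         Σ Baire λ y → (ΨC ^ join c q ≃ y) × sol (SRT2 k) c y
decode {k} c (_ , stable) q (_ , (i , monochromatic) , copy) = image elements , ΨC-computes , solution {k}
  where
  open Decoding c stable q i (λ x qx≡1 → trans (sym (oddPart-presentation c x)) (monochromatic x qx≡1))
    (IsoToE-resp-⇔ (λ u v → presentation-related c (proj₁ u) (proj₁ v)) copy)

lemma5p3 : (k : ℕ) → k ≥ 1 → SRT2 k ≤W IndE k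
lemma5p3 k _ = ΔC , ΨC , λ c c∈dom → presentation c , ΔC-computes c , presentation-dom c c∈dom , decode c c∈dom
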